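{- Let $K$ be a field with $\mathrm{char}(K)\neq 2$, let $\lambda\in K\setminus\{0,\pm1\}$, and let $\mathcal{E}_{1,\lambda}$ be the elliptic curve $y^2=(x+\lambda^2)(x+1)x$ over $K$. Let $Q\in\mathcal{E}_{1,\lambda}(K)$ be a point with $x(Q)=\lambda$. Then $Q$ is divisible by $2$ in $\mathcal{E}_{1,\lambda}(K)$ if and only if there exists $c\in K$ with $c\notin\{0,\pm1,\pm1\pm\sqrt{2},\pm\sqrt{ -1}\}$ such that $$\lambda=\left[\frac{c-\frac1c}{2}\right]^2.$$
   Context: The excluded set $\{0,\pm1,\pm1\pm\sqrt2,\pm\sqrt{ -1}\}$ means all elements of $K$ equal to $0,\pm1$, or to a square root of $-1$, or to $\pm1\pm s$ with $s^2=2$ (those that exist in $K$). -}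

module Defs where

open import Level using (Level; _⊔_; suc; Lift)
open import Data.Unit using (⊤)
open import Algebra.Bundles using (CommutativeRing)
open import Data.Product using (Σ; ∃; _×_; _,_)
open import Relation.Nullary using (¬_)

record Field (c ℓ : Level) : Set (suc (c ⊔ ℓ)) where
  field
    commutativeRing : CommutativeRing c ℓ
  open CommutativeRing commutativeRing public
  field
    0≉1   : ¬ (0# ≈ 1#)
    inv   : (x : Carrier) → ¬ (x ≈ 0#) → Carrier
    inv-r : (x : Carrier) (p : ¬ (x ≈ 0#)) → x * inv x p ≈ 1#

module EllipticCurve {c ℓ : Level} (K : Field c ℓ) where
  open Field K public

  2# 3# : Carrier
  2# = 1# + 1#
  3# = 2# + 1#

  _² : Carrier → Carrier
  x ² = x * x

  data Point : Set c where
    O   : Point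
    aff : Carrier → Carrier → Point

  OnCurve : Carrier → Carrier → Point → Set ℓ
  OnCurve A B O         = Lift ℓ ⊤
  OnCurve A B (aff x y) = y ² ≈ x * x ² + A * x ² + B * x

  -- Doubling on E_{A,B} (chord–tangent law, P + P): the relation
  -- "Dbl A B P R" means 2P = R.
  --   2O = O;  2(x,y) = O if y = 0;
  --   otherwise, with slope m = (3x² + 2Ax + B)/(2y),
  --   2(x,y) = (m² − A − 2x , −(y + m (x' − x))).
  data Dbl (A B : Carrier) : Point → Point → Set (c ⊔ ℓ) where
    dbl-O   : Dbl A B O O
    dbl-tor : ∀ {x y} → y ≈ 0# → Dbl A B (aff x y) O
    dbl-aff : ∀ {x y x' y'} (p : ¬ (2# * y ≈ 0#)) →
              let m = (3# * x ² + 2# * A * x + B) * inv (2# * y) p in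
              x' ≈ m ² - A - 2# * x →
              y' ≈ - (y + m * (x' - x)) →
              Dbl A B (aff x y) (aff x' y')

  DivisibleBy2 : Carrier → Carrier → Point → Set (c ⊔ ℓ)
  DivisibleBy2 A B R = Σ Point λ P → OnCurve A B P × Dbl A B P R

  -- E_{1,λ} : y² = (x + λ²)(x + 1)x = x³ + (λ² + 1)x² + λ² x.
  A₁ : Carrier → Carrier
  A₁ λ′ = λ′ ² + 1#
  B₁ : Carrier → Carrier
  B₁ λ′ = λ′ ²

  OnE₁ : Carrier → Point → Set ℓ
  OnE₁ λ′ O         = Lift ℓ ⊤
  OnE₁ λ′ (aff x y) = y ² ≈ (x + λ′ ²) * (x + 1#) * x

  DivisibleBy2E₁ : Carrier → Point → Set (c ⊔ ℓ)
  DivisibleBy2E₁ λ′ R = Σ Point λ P → OnE₁ λ′ P × Dbl (A₁ λ′) (B₁ λ′) P R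

  -- c ∉ {0, ±1, ±1 ± √2, ±√−1} (only roots existing in K are meant).
  Admissible : Carrier → Set (c ⊔ ℓ)
  Admissible x =
    ¬ (x ≈ 0#) × ¬ (x ≈ 1#) × ¬ (x ≈ - 1#) ×
    (∀ s → s ² ≈ 2# → ¬ (x ≈ 1# + s) × ¬ (x ≈ 1# - s) × ¬ (x ≈ - 1# + s) × ¬ (x ≈ - 1# - s)) ×
    (∀ i → i ² ≈ - 1# → ¬ (x ≈ i))

module Submission where

open import Defs
open import Level using (Level)
open import Data.Product using (Σ; _×_; proj₁)
open import Function.Bundles using (_⇔_)
open import Relation.Nullary using (¬_)

open import Level using (_⊔_)
open import Algebra.Bundles using (CommutativeRing)
open import Data.Nat as ℕ using (zero; suc)
import Data.Nat.Properties as ℕₚ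
open import Data.Integer as ℤ using (ℤ; +_; -[1+_]; _⊖_; sign; ∣_∣; _◃_)
import Data.Integer.Properties as ℤₚ
open import Data.Sign as Sign using (Sign)
open import Data.Maybe as Maybe using (Maybe)
open import Data.Product using (_,_)
open import Function.Bundles using (mk⇔)
open import Relation.Binary.Consequences using (dec⇒weaklyDec)
open import Relation.Binary.PropositionalEquality as ≡ using (_≡_)

-- The 2-torsion points of E_{1,λ} have abscissas 0, −1 and −λ².  By 2-descent, Q is twice a
-- rational point iff x(Q) − e is a square for each such abscissa e; for x(Q) = λ this says that
-- λ and λ + 1 are squares (then so is λ(λ + 1)).  Both halves of this criterion are made explicit
-- for an arbitrary curve E_{A,B} : y² = x³ + Ax² + Bx:
--   * if P = (x, y) and (r, 0) is 2-torsion, then x(2P) − r = (G / 2y)² for a polynomial G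
--     (double-minus-root-square);
--   * on y² = x(x + q)(x + p) with q = b² − a², p = t² − a², the point (a², abt) is twice the
--     point with abscissa a² + ab + at + bt and tangent slope a + b + t (halving).
-- Finally, λ = a² and λ + 1 = b² are rewritten via c = a + b, 1/c = b − a, so that
-- a = (c − 1/c)/2; the excluded values of c are exactly those forcing λ ∈ {0, ±1} (Parametrisation).

module IntegerCoefficients {c ℓ} (R : CommutativeRing c ℓ) where
  open CommutativeRing R
  open import Algebra.Properties.Semiring.Mult.TCOptimised semiring
    using (×-homo-+; ×1-homo-*; 1+×) renaming (_×_ to _·_)
  open import Algebra.Properties.Ring ring using (-1*x≈-x)
  open import Algebra.Properties.AbelianGroup +-abelianGroup
    using (⁻¹-∙-comm; ε⁻¹≈ε; ⁻¹-involutive)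
  open import Algebra.Properties.CommutativeSemigroup *-commutativeSemigroup
    using (interchange)
  open import Algebra.Solver.Ring.AlmostCommutativeRing
    using (_-Raw-AlmostCommutative⟶_; fromCommutativeRing)
  open import Relation.Binary.Reasoning.Setoid setoid

  -- The canonical map ℤ → R.  Since 1 · 1# = 1#, 2 · 1# = 1# + 1#, …, integer
  -- constants in solver expressions denote the ring's own numerals definitionally.
  ι : ℤ → Carrier
  ι (+ n)    = n · 1#
  ι -[1+ n ] = - (suc n · 1#)

  x-0≈x : ∀ x → x - 0# ≈ x
  x-0≈x x = trans (+-congˡ ε⁻¹≈ε) (+-identityʳ x)

  [1+x]-[1+y]≈x-y : ∀ x y → (1# + x) - (1# + y) ≈ x - y
  [1+x]-[1+y]≈x-y x y = begin
    (1# + x) + - (1# + y)    ≈⟨ +-cong (+-comm 1# x) (sym (⁻¹-∙-comm 1# y)) ⟩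
    (x + 1#) + (- 1# + - y)  ≈⟨ +-assoc x 1# _ ⟩
    x + (1# + (- 1# + - y))  ≈⟨ +-congˡ (sym (+-assoc 1# (- 1#) (- y))) ⟩
    x + ((1# - 1#) + - y)    ≈⟨ +-congˡ (trans (+-congʳ (-‿inverseʳ 1#)) (+-identityˡ (- y))) ⟩
    x - y                    ∎

  ι-⊖ : ∀ m n → ι (m ⊖ n) ≈ m · 1# - n · 1#
  ι-⊖ zero    zero    = sym (x-0≈x 0#)
  ι-⊖ (suc m) zero    = sym (x-0≈x _)
  ι-⊖ zero    (suc n) = sym (+-identityˡ _)
  ι-⊖ (suc m) (suc n) = begin
    ι (suc m ⊖ suc n)              ≡⟨ ≡.cong ι (ℤₚ.[1+m]⊖[1+n]≡m⊖n m n) ⟩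
    ι (m ⊖ n)                      ≈⟨ ι-⊖ m n ⟩
    m · 1# - n · 1#                ≈⟨ [1+x]-[1+y]≈x-y _ _ ⟨
    (1# + m · 1#) - (1# + n · 1#)  ≈⟨ +-cong (1+× m 1#) (-‿cong (1+× n 1#)) ⟨
    suc m · 1# - suc n · 1#        ∎

  ι-+ : ∀ i j → ι (i ℤ.+ j) ≈ ι i + ι j
  ι-+ (+ m)    (+ n)    = ×-homo-+ 1# m n
  ι-+ (+ m)    -[1+ n ] = ι-⊖ m (suc n)
  ι-+ -[1+ m ] (+ n)    = trans (ι-⊖ n (suc m)) (+-comm _ _)
  ι-+ -[1+ m ] -[1+ n ] = begin
    - (suc (suc (m ℕ.+ n)) · 1#)     ≡⟨ ≡.cong (λ k → - (suc k · 1#)) (ℕₚ.+-suc m n) ⟨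
    - ((suc m ℕ.+ suc n) · 1#)       ≈⟨ -‿cong (×-homo-+ 1# (suc m) (suc n)) ⟩
    - (suc m · 1# + suc n · 1#)      ≈⟨ ⁻¹-∙-comm _ _ ⟨
    - (suc m · 1#) + - (suc n · 1#)  ∎

  σ : Sign → Carrier
  σ Sign.+ = 1#
  σ Sign.- = - 1#

  σ-* : ∀ s t → σ (s Sign.* t) ≈ σ s * σ t
  σ-* Sign.+ Sign.+ = sym (*-identityˡ _)
  σ-* Sign.+ Sign.- = sym (*-identityˡ _)
  σ-* Sign.- Sign.+ = sym (*-identityʳ _)
  σ-* Sign.- Sign.- = sym (trans (-1*x≈-x _) (⁻¹-involutive _))

  ι-◃ : ∀ s n → ι (s ◃ n) ≈ σ s * (n · 1#)
  ι-◃ s      zero    = sym (zeroʳ _)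
  ι-◃ Sign.+ (suc n) = sym (*-identityˡ _)
  ι-◃ Sign.- (suc n) = sym (-1*x≈-x _)

  ι-sign-abs : ∀ i → ι i ≈ σ (sign i) * (∣ i ∣ · 1#)
  ι-sign-abs i = trans (reflexive (≡.cong ι (≡.sym (ℤₚ.◃-inverse i)))) (ι-◃ (sign i) ∣ i ∣)

  ι-* : ∀ i j → ι (i ℤ.* j) ≈ ι i * ι j
  ι-* i j = begin
    ι (i ℤ.* j)                                                ≈⟨ ι-◃ (sign i Sign.* sign j) (∣ i ∣ ℕ.* ∣ j ∣) ⟩
    σ (sign i Sign.* sign j) * ((∣ i ∣ ℕ.* ∣ j ∣) · 1#)        ≈⟨ *-cong (σ-* (sign i) (sign j)) (×1-homo-* ∣ i ∣ ∣ j ∣) ⟩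
    (σ (sign i) * σ (sign j)) * ((∣ i ∣ · 1#) * (∣ j ∣ · 1#))  ≈⟨ interchange _ _ _ _ ⟩
    (σ (sign i) * (∣ i ∣ · 1#)) * (σ (sign j) * (∣ j ∣ · 1#))  ≈⟨ *-cong (ι-sign-abs i) (ι-sign-abs j) ⟨
    ι i * ι j                                                  ∎

  ι-neg : ∀ i → ι (ℤ.- i) ≈ - ι i
  ι-neg (+ zero)  = sym ε⁻¹≈ε
  ι-neg (+ suc n) = refl
  ι-neg -[1+ n ]  = sym (⁻¹-involutive _)

  ι-morphism : ℤ.+-*-rawRing -Raw-AlmostCommutative⟶ fromCommutativeRing R
  ι-morphism = record
    { ⟦_⟧ = ι ; +-homo = ι-+ ; *-homo = ι-* ; -‿homo = ι-neg ; 0-homo = refl ; 1-homo = refl }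

  -- Equal integer coefficients have equal images (all the solver needs to compare constants).
  ι-≟ : ∀ i j → Maybe (ι i ≈ ι j)
  ι-≟ i j = Maybe.map (λ { ≡.refl → refl }) (dec⇒weaklyDec ℤ._≟_ i j)

  open import Algebra.Solver.Ring ℤ.+-*-rawRing (fromCommutativeRing R) ι-morphism ι-≟ public
    using (solve; _:=_; con; _:+_; _:*_; _:-_; :-_)

module FieldFacts {c ℓ} (K : Field c ℓ) where
  open EllipticCurve K
  open import Algebra.Properties.Ring ring using (x[y-z]≈xy-xz)
  open import Algebra.Properties.AbelianGroup +-abelianGroup using (x∙y⁻¹≈ε⇒x≈y; x≈y⇒x∙y⁻¹≈ε)
  open import Relation.Binary.Reasoning.Setoid setoid

  IsSquare : Carrier → Set (c ⊔ ℓ)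
  IsSquare z = Σ Carrier λ s → s ² ≈ z

  square-resp : ∀ {z z′} → z ≈ z′ → IsSquare z → IsSquare z′
  square-resp z≈z′ (s , s²≈z) = s , trans s²≈z z≈z′

  inv-unique : ∀ {x y z} → x * y ≈ 1# → x * z ≈ 1# → y ≈ z
  inv-unique {x} {y} {z} xy≈1 xz≈1 = begin
    y            ≈⟨ *-identityʳ y ⟨
    y * 1#       ≈⟨ *-congˡ xz≈1 ⟨
    y * (x * z)  ≈⟨ *-assoc y x z ⟨
    (y * x) * z  ≈⟨ *-congʳ (trans (*-comm y x) xy≈1) ⟩
    1# * z       ≈⟨ *-identityˡ z ⟩
    z            ∎

  nonzero-cancel : ∀ {k x} → ¬ (k ≈ 0#) → k * x ≈ 0# → x ≈ 0#
  nonzero-cancel {k} {x} k≢0 kx≈0 = begin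
    x                  ≈⟨ *-identityˡ x ⟨
    1# * x             ≈⟨ *-congʳ (trans (*-comm _ _) (inv-r k k≢0)) ⟨
    (k⁻¹ * k) * x      ≈⟨ *-assoc k⁻¹ k x ⟩
    k⁻¹ * (k * x)      ≈⟨ *-congˡ kx≈0 ⟩
    k⁻¹ * 0#           ≈⟨ zeroʳ k⁻¹ ⟩
    0#                 ∎
    where k⁻¹ = inv k k≢0

  *-nonzero : ∀ {x y} → ¬ (x ≈ 0#) → ¬ (y ≈ 0#) → ¬ (x * y ≈ 0#)
  *-nonzero x≢0 y≢0 xy≈0 = y≢0 (nonzero-cancel x≢0 xy≈0)

  *-cancelˡ : ∀ {k x y} → ¬ (k ≈ 0#) → k * x ≈ k * y → x ≈ y
  *-cancelˡ {k} {x} {y} k≢0 kx≈ky =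
    x∙y⁻¹≈ε⇒x≈y x y (nonzero-cancel k≢0 (trans (x[y-z]≈xy-xz k x y) (x≈y⇒x∙y⁻¹≈ε kx≈ky)))

  factor-nonzero : ∀ {x y z} → x * y ≈ z → ¬ (z ≈ 0#) → ¬ (x ≈ 0#)
  factor-nonzero {x} {y} xy≈z z≢0 x≈0 = z≢0 (trans (sym xy≈z) (trans (*-congʳ x≈0) (zeroˡ y)))

  unit-nonzero : ∀ {x y} → x * y ≈ 1# → ¬ (x ≈ 0#)
  unit-nonzero xy≈1 = factor-nonzero xy≈1 (λ 1≈0 → 0≉1 (sym 1≈0))

  divide : ∀ {X m d} (d≢0 : ¬ (d ≈ 0#)) → X ≈ m * d → X * inv d d≢0 ≈ m
  divide {X} {m} {d} d≢0 X≈md = begin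
    X * inv d d≢0          ≈⟨ *-congʳ X≈md ⟩
    (m * d) * inv d d≢0    ≈⟨ *-assoc m d _ ⟩
    m * (d * inv d d≢0)    ≈⟨ *-congˡ (inv-r d d≢0) ⟩
    m * 1#                 ≈⟨ *-identityʳ m ⟩
    m                      ∎

-- With λ = a², λ + 1 = b² one has (a + b)(b − a) = 1, so c = a + b works and
-- a = (c − 1/c)/2; conversely a = (c − 1/c)/2 and b = (c + 1/c)/2 satisfy b² = a² + 1.
module Parametrisation {c ℓ} (K : Field c ℓ) where
  open EllipticCurve K
  open FieldFacts K
  open IntegerCoefficients commutativeRing using (solve; _:=_; con; _:+_; _:*_; _:-_; :-_)
  open import Relation.Binary.Reasoning.Setoid setoid

  consecutive-squares : ∀ {λ′ a b} → a ² ≈ λ′ → b ² ≈ λ′ + 1# → b ² - a ² ≈ 1#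
  consecutive-squares {λ′} a²≈λ b²≈λ+1 =
    trans (+-cong b²≈λ+1 (-‿cong a²≈λ)) (solve 1 (λ l → (l :+ con (+ 1)) :- l := con (+ 1)) refl λ′)

  module _ (char≠2 : ¬ (2# ≈ 0#)) where

    ½ : Carrier
    ½ = inv 2# char≠2

    halve : ∀ x → x ≈ 2# * (x * ½)
    halve x = begin
      x              ≈⟨ *-identityʳ x ⟨
      x * 1#         ≈⟨ *-congˡ (inv-r 2# char≠2) ⟨
      x * (2# * ½)   ≈⟨ solve 2 (λ x h → x :* (con (+ 2) :* h) := con (+ 2) :* (x :* h)) refl x ½ ⟩
      2# * (x * ½)   ∎

    parameter⇒squares : ∀ {λ′ c} (c≢0 : ¬ (c ≈ 0#)) → λ′ ≈ ((c - inv c c≢0) * ½) ² →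
                        IsSquare λ′ × IsSquare (λ′ + 1#)
    parameter⇒squares {λ′} {c} c≢0 λ≈a² = (a , sym λ≈a²) , (b , b²≈λ+1)
      where
      d a b : Carrier
      d = inv c c≢0
      a = (c - d) * ½
      b = (c + d) * ½
      b²≈λ+1 : b ² ≈ λ′ + 1#
      b²≈λ+1 = begin
        b ²                                     ≈⟨ solve 3 (λ c d h →
                                                     ((c :+ d) :* h) :* ((c :+ d) :* h)
                                                  := ((c :- d) :* h) :* ((c :- d) :* h)
                                                     :+ (c :* d) :* ((con (+ 2) :* h) :* (con (+ 2) :* h))) refl c d ½ ⟩
        a ² + (c * d) * ((2# * ½) * (2# * ½))  ≈⟨ +-cong (sym λ≈a²) (*-cong (inv-r c c≢0) (*-cong (inv-r 2# char≠2) (inv-r 2# char≠2))) ⟩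
        λ′ + 1# * (1# * 1#)                     ≈⟨ +-congˡ (trans (*-identityˡ _) (*-identityˡ 1#)) ⟩
        λ′ + 1#                                 ∎

    squares⇒parameter : ∀ {λ′} → ¬ (λ′ ≈ 0#) → ¬ (λ′ ≈ 1#) → ¬ (λ′ ≈ - 1#) →
                        IsSquare λ′ × IsSquare (λ′ + 1#) →
                        Σ Carrier λ c → Σ (Admissible c) λ adm → λ′ ≈ ((c - inv c (proj₁ adm)) * ½) ²
    squares⇒parameter {λ′} λ≢0 λ≢1 λ≢-1 ((a , a²≈λ) , (b , b²≈λ+1)) =
      a + b , admissible , recover _ _ _ refl (inv-r (a + b) c≢0) (halve _)
      where
      unit : (a + b) * (b - a) ≈ 1#
      unit = trans (solve 2 (λ a b → (a :+ b) :* (b :- a) := b :* b :- a :* a) refl a b)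
                   (consecutive-squares a²≈λ b²≈λ+1)

      c≢0 : ¬ (a + b ≈ 0#)
      c≢0 = unit-nonzero unit

      recover : ∀ v w s → a + b ≈ v → v * w ≈ 1# → v - w ≈ 2# * s → λ′ ≈ s ²
      recover v w s c≈v vw≈1 v-w≈2s = trans (sym a²≈λ) (*-cong a≈s a≈s)
        where
        w≈b-a : w ≈ b - a
        w≈b-a = inv-unique (trans (*-congʳ c≈v) vw≈1) unit
        a≈s : a ≈ s
        a≈s = *-cancelˡ char≠2 (begin
          2# * a             ≈⟨ solve 2 (λ a b → con (+ 2) :* a := (a :+ b) :- (b :- a)) refl a b ⟩
          (a + b) - (b - a)  ≈⟨ +-cong c≈v (-‿cong (sym w≈b-a)) ⟩
          v - w              ≈⟨ v-w≈2s ⟩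
          2# * s             ∎)

      -- c = e with e² = 1 would give λ = 0.
      not-unit-root : ∀ {e} → e * e ≈ 1# → ¬ (a + b ≈ e)
      not-unit-root {e} e²≈1 c≈e = λ≢0 (trans
        (recover e e 0# c≈e e²≈1 (solve 1 (λ e → e :- e := con (+ 2) :* con (+ 0)) refl e))
        (zeroˡ 0#))

      -- c = e + r with e² = 1, r² = 2 would give λ = 1 (then 1/c = r − e).
      not-shifted-root : ∀ {e r} → e * e ≈ 1# → r * r ≈ 2# → ¬ (a + b ≈ e + r)
      not-shifted-root {e} {r} e²≈1 r²≈2 c≈e+r = λ≢1 (trans
        (recover (e + r) (r - e) e c≈e+r product
          (solve 2 (λ e r → (e :+ r) :- (r :- e) := con (+ 2) :* e) refl e r))
        e²≈1)
        where
        product : (e + r) * (r - e) ≈ 1#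
        product = begin
          (e + r) * (r - e)  ≈⟨ solve 2 (λ e r → (e :+ r) :* (r :- e) := r :* r :- e :* e) refl e r ⟩
          r * r - e * e      ≈⟨ +-cong r²≈2 (-‿cong e²≈1) ⟩
          2# - 1#            ≈⟨ solve 0 (con (+ 2) :- con (+ 1) := con (+ 1)) refl ⟩
          1#                 ∎

      -- c = i with i² = −1 would give λ = −1 (then 1/c = −i).
      not-imaginary : ∀ {i} → i * i ≈ - 1# → ¬ (a + b ≈ i)
      not-imaginary {i} i²≈-1 c≈i = λ≢-1 (trans
        (recover i (- i) i c≈i product (solve 1 (λ i → i :- (:- i) := con (+ 2) :* i) refl i))
        i²≈-1)
        where
        product : i * - i ≈ 1#
        product = begin
          i * - i    ≈⟨ solve 1 (λ i → i :* (:- i) := :- (i :* i)) refl i ⟩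
          - (i * i)  ≈⟨ -‿cong i²≈-1 ⟩
          - - 1#     ≈⟨ solve 0 (:- (:- con (+ 1)) := con (+ 1)) refl ⟩
          1#         ∎

      one² : 1# * 1# ≈ 1#
      one² = *-identityˡ 1#

      minus-one² : - 1# * - 1# ≈ 1#
      minus-one² = solve 0 ((:- con (+ 1)) :* (:- con (+ 1)) := con (+ 1)) refl

      negate-root : ∀ {s} → s * s ≈ 2# → - s * - s ≈ 2#
      negate-root {s} s²≈2 = trans (solve 1 (λ s → (:- s) :* (:- s) := s :* s) refl s) s²≈2

      admissible : Admissible (a + b)
      admissible = c≢0
                 , not-unit-root one²
                 , not-unit-root minus-one²
                 , (λ s s²≈2 → not-shifted-root one² s²≈2
                             , not-shifted-root one² (negate-root s²≈2)
                             , not-shifted-root minus-one² s²≈2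
                             , not-shifted-root minus-one² (negate-root s²≈2))
                 , (λ i i²≈-1 → not-imaginary i²≈-1)

module WeierstrassCurves {c ℓ} (K : Field c ℓ) where
  open EllipticCurve K
  open FieldFacts K
  open IntegerCoefficients commutativeRing using (solve; _:=_; con; _:+_; _:*_; _:-_; :-_)
  open import Algebra.Properties.AbelianGroup +-abelianGroup using (x∙y⁻¹≈ε⇒x≈y)
  open import Relation.Binary.Reasoning.Setoid setoid

  onCurve-resp : ∀ {A A′ B B′} → A ≈ A′ → B ≈ B′ → ∀ P → OnCurve A B P → OnCurve A′ B′ P
  onCurve-resp A≈ B≈ O         on = on
  onCurve-resp A≈ B≈ (aff x y) on =
    trans on (+-cong (+-congˡ (*-congʳ A≈)) (*-congʳ B≈))

  dbl-resp : ∀ {A A′ B B′ P x₁ y₁ x₂ y₂} → A ≈ A′ → B ≈ B′ → x₁ ≈ x₂ → y₁ ≈ y₂ →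
             Dbl A B P (aff x₁ y₁) → Dbl A′ B′ P (aff x₂ y₂)
  dbl-resp {A} {A′} {B} {B′} A≈ B≈ x₁≈x₂ y₁≈y₂ (dbl-aff {x} {y} 2y≢0 x₁≈ y₁≈) =
    dbl-aff 2y≢0
      (trans (sym x₁≈x₂) (trans x₁≈ (+-congʳ (+-cong (*-cong m≈m′ m≈m′) (-‿cong A≈)))))
      (trans (sym y₁≈y₂) (trans y₁≈ (-‿cong (+-congˡ (*-cong m≈m′ (+-congʳ x₁≈x₂))))))
    where
    m≈m′ : (3# * x ² + 2# * A * x + B) * inv (2# * y) 2y≢0 ≈ (3# * x ² + 2# * A′ * x + B′) * inv (2# * y) 2y≢0
    m≈m′ = *-congʳ (+-cong (+-congˡ (*-congʳ (*-congˡ A≈))) B≈)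

  divisible-resp : ∀ {A A′ B B′ x₁ y₁ x₂ y₂} → A ≈ A′ → B ≈ B′ → x₁ ≈ x₂ → y₁ ≈ y₂ →
                   DivisibleBy2 A B (aff x₁ y₁) → DivisibleBy2 A′ B′ (aff x₂ y₂)
  divisible-resp A≈ B≈ x≈ y≈ (P , onP , dbl) = P , onCurve-resp A≈ B≈ P onP , dbl-resp A≈ B≈ x≈ y≈ dbl

  origin-torsion : ∀ A B → OnCurve A B (aff 0# 0#)
  origin-torsion = solve 2 (λ A B → con (+ 0) :* con (+ 0)
    := con (+ 0) :* (con (+ 0) :* con (+ 0)) :+ A :* (con (+ 0) :* con (+ 0)) :+ B :* con (+ 0)) refl

  -- The identity behind 2-descent.  With F = 3x² + 2Ax + B (numerator of the tangent slope),
  -- C = x³ + Ax² + Bx, T = r³ + Ar² + Br and G = x² − 2rx − 2r(A + r) − B: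
  --   F² − 4(A + 2x + r) C = G² − 4(A + 2x + r) T.
  descent-identity : ∀ x r A B u →
    ((3# * x ² + 2# * A * x + B) * u) ² - (A + 2# * x + r) * ((2# * u) ² * (x * x ² + A * x ² + B * x))
    ≈ ((x ² - 2# * r * x - 2# * r * (A + r) - B) * u) ² - (A + 2# * x + r) * ((2# * u) ² * (r * r ² + A * r ² + B * r))
  descent-identity = solve 5 (λ x r A B u →
    let sq = λ z → z :* z
        k  = A :+ con (+ 2) :* x :+ r
    in  sq ((con (+ 3) :* sq x :+ con (+ 2) :* A :* x :+ B) :* u)
          :- k :* (sq (con (+ 2) :* u) :* (x :* sq x :+ A :* sq x :+ B :* x))
     := sq ((sq x :- con (+ 2) :* r :* x :- con (+ 2) :* r :* (A :+ r) :- B) :* u)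
          :- k :* (sq (con (+ 2) :* u) :* (r :* sq r :+ A :* sq r :+ B :* r))) refl

  double-minus-root-square : ∀ {A B x y x′ y′ r} → OnCurve A B (aff x y) → OnCurve A B (aff r 0#) →
                             Dbl A B (aff x y) (aff x′ y′) → IsSquare (x′ - r)
  double-minus-root-square {A} {B} {x} {y} {x′} {r = r} onP onT (dbl-aff 2y≢0 x′≈ _) =
    G * u , sym (begin
      x′ - r                       ≈⟨ +-congʳ x′≈ ⟩
      (F * u) ² - A - 2# * x - r   ≈⟨ solve 4 (λ X A x r → X :- A :- con (+ 2) :* x :- r
                                                := X :- (A :+ con (+ 2) :* x :+ r) :* con (+ 1)) refl _ A x r ⟩
      (F * u) ² - k * 1#           ≈⟨ +-congˡ (-‿cong (*-congˡ 4u²C≈1)) ⟨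
      (F * u) ² - k * ((2# * u) ² * (x * x ² + A * x ² + B * x))
                                   ≈⟨ descent-identity x r A B u ⟩
      (G * u) ² - k * ((2# * u) ² * (r * r ² + A * r ² + B * r))
                                   ≈⟨ +-congˡ (-‿cong (*-congˡ (*-congˡ onT))) ⟨
      (G * u) ² - k * ((2# * u) ² * 0# ²)
                                   ≈⟨ solve 3 (λ X k u → X :- k :* ((con (+ 2) :* u) :* (con (+ 2) :* u) :* (con (+ 0) :* con (+ 0)))
                                                := X) refl _ k u ⟩
      (G * u) ²                    ∎)
    where
    u F G k : Carrier
    u = inv (2# * y) 2y≢0
    F = 3# * x ² + 2# * A * x + B
    G = x ² - 2# * r * x - 2# * r * (A + r) - B
    k = A + 2# * x + r
    -- 4u²C = (2yu)² = 1, using y² = C.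
    4u²C≈1 : (2# * u) ² * (x * x ² + A * x ² + B * x) ≈ 1#
    4u²C≈1 = begin
      (2# * u) ² * (x * x ² + A * x ² + B * x)  ≈⟨ *-congˡ onP ⟨
      (2# * u) ² * y ²                          ≈⟨ solve 2 (λ u y → (con (+ 2) :* u) :* (con (+ 2) :* u) :* (y :* y)
                                                             := (con (+ 2) :* y :* u) :* (con (+ 2) :* y :* u)) refl u y ⟩
      (2# * y * u) ²                            ≈⟨ *-cong (inv-r (2# * y) 2y≢0) (inv-r (2# * y) 2y≢0) ⟩
      1# * 1#                                   ≈⟨ *-identityˡ 1# ⟩
      1#                                        ∎

  -- On y² = x(x + q)(x + p) with q = b² − a², p = t² − a² (a nonsingular curve:
  -- its 2-torsion abscissas 0, −q, −p are distinct), the point (a², abt) is twice the point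
  -- P = (a² + ab + at + bt, yP) whose tangent has slope a + b + t.
  halving : ¬ (2# ≈ 0#) → ∀ a b t → let q = b ² - a ²; p = t ² - a ² in
            ¬ (q ≈ 0#) → ¬ (p ≈ 0#) → ¬ (p ≈ q) →
            DivisibleBy2 (q + p) (q * p) (aff (a ²) (a * b * t))
  halving char≠2 a b t q≢0 p≢0 p≢q = aff xP yP , on-curve , dbl-aff 2yP≢0 abscissa ordinate
    where
    q p xP m yP : Carrier
    q  = b ² - a ²
    p  = t ² - a ²
    xP = a ² + a * b + a * t + b * t
    m  = a + b + t
    yP = m * (xP - a ²) - a * b * t

    on-curve : OnCurve (q + p) (q * p) (aff xP yP)
    on-curve = solve 3 (λ a b t →
      let sq = λ z → z :* z
          q  = sq b :- sq a
          p  = sq t :- sq a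
          xP = sq a :+ a :* b :+ a :* t :+ b :* t
          yP = (a :+ b :+ t) :* (xP :- sq a) :- a :* b :* t
      in  sq yP := xP :* sq xP :+ (q :+ p) :* sq xP :+ (q :* p) :* xP) refl a b t

    tangent : 3# * xP ² + 2# * (q + p) * xP + q * p ≈ m * (2# * yP)
    tangent = solve 3 (λ a b t →
      let sq = λ z → z :* z
          q  = sq b :- sq a
          p  = sq t :- sq a
          xP = sq a :+ a :* b :+ a :* t :+ b :* t
          m  = a :+ b :+ t
          yP = m :* (xP :- sq a) :- a :* b :* t
      in  con (+ 3) :* sq xP :+ con (+ 2) :* (q :+ p) :* xP :+ q :* p := m :* (con (+ 2) :* yP)) refl a b t

    -- yP factors as (a + b)(a + t)(b + t), and each factor is nonzero by nonsingularity.
    yP-factors : yP ≈ (a + b) * (a + t) * (b + t)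
    yP-factors = solve 3 (λ a b t →
      let xP = a :* a :+ a :* b :+ a :* t :+ b :* t
      in  (a :+ b :+ t) :* (xP :- a :* a) :- a :* b :* t := (a :+ b) :* (a :+ t) :* (b :+ t)) refl a b t

    a+b≢0 : ¬ (a + b ≈ 0#)
    a+b≢0 = factor-nonzero (solve 2 (λ a b → (a :+ b) :* (b :- a) := b :* b :- a :* a) refl a b) q≢0

    a+t≢0 : ¬ (a + t ≈ 0#)
    a+t≢0 = factor-nonzero (solve 2 (λ a t → (a :+ t) :* (t :- a) := t :* t :- a :* a) refl a t) p≢0

    b+t≢0 : ¬ (b + t ≈ 0#)
    b+t≢0 = factor-nonzero (solve 3 (λ a b t → (b :+ t) :* (t :- b) := (t :* t :- a :* a) :- (b :* b :- a :* a)) refl a b t)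
                           (λ p-q≈0 → p≢q (x∙y⁻¹≈ε⇒x≈y p q p-q≈0))

    2yP≢0 : ¬ (2# * yP ≈ 0#)
    2yP≢0 2yP≈0 = *-nonzero char≠2 (*-nonzero (*-nonzero a+b≢0 a+t≢0) b+t≢0)
                             (trans (*-congˡ (sym yP-factors)) 2yP≈0)

    slope≈m : (3# * xP ² + 2# * (q + p) * xP + q * p) * inv (2# * yP) 2yP≢0 ≈ m
    slope≈m = divide 2yP≢0 tangent

    abscissa : a ² ≈ ((3# * xP ² + 2# * (q + p) * xP + q * p) * inv (2# * yP) 2yP≢0) ² - (q + p) - 2# * xP
    abscissa = trans
      (solve 3 (λ a b t →
        let sq = λ z → z :* z
            xP = sq a :+ a :* b :+ a :* t :+ b :* t
            m  = a :+ b :+ t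
        in  sq a := sq m :- ((sq b :- sq a) :+ (sq t :- sq a)) :- con (+ 2) :* xP) refl a b t)
      (+-congʳ (+-congʳ (*-cong (sym slope≈m) (sym slope≈m))))

    ordinate : a * b * t ≈ - (yP + (3# * xP ² + 2# * (q + p) * xP + q * p) * inv (2# * yP) 2yP≢0 * (a ² - xP))
    ordinate = trans
      (solve 3 (λ a b t →
        let xP = a :* a :+ a :* b :+ a :* t :+ b :* t
            m  = a :+ b :+ t
        in  a :* b :* t := :- ((m :* (xP :- a :* a) :- a :* b :* t) :+ m :* (a :* a :- xP))) refl a b t)
      (-‿cong (+-congˡ (*-congʳ (sym slope≈m))))

module CurveE₁ {c ℓ} (K : Field c ℓ) where
  open EllipticCurve K
  open FieldFacts K
  open Parametrisation K using (consecutive-squares)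
  open WeierstrassCurves K
  open IntegerCoefficients commutativeRing using (solve; _:=_; con; _:+_; _:*_; _:-_; :-_; x-0≈x)
  open import Algebra.Properties.AbelianGroup +-abelianGroup
    using (⁻¹-involutive; inverseˡ-unique; x∙y⁻¹≈ε⇒x≈y)
  open import Relation.Binary.Reasoning.Setoid setoid

  factored-form : ∀ λ′ x → (x + λ′ ²) * (x + 1#) * x ≈ x * x ² + A₁ λ′ * x ² + B₁ λ′ * x
  factored-form = solve 2 (λ l x → (x :+ l :* l) :* (x :+ con (+ 1)) :* x
                                 := x :* (x :* x) :+ (l :* l :+ con (+ 1)) :* (x :* x) :+ (l :* l) :* x) refl

  onE₁⇒onCurve : ∀ {λ′} P → OnE₁ λ′ P → OnCurve (A₁ λ′) (B₁ λ′) P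
  onE₁⇒onCurve O         on = on
  onE₁⇒onCurve (aff x y) on = trans on (factored-form _ x)

  onCurve⇒onE₁ : ∀ {λ′} P → OnCurve (A₁ λ′) (B₁ λ′) P → OnE₁ λ′ P
  onCurve⇒onE₁ O         on = on
  onCurve⇒onE₁ (aff x y) on = trans on (sym (factored-form _ x))

  minus-one-torsion : ∀ λ′ → OnCurve (A₁ λ′) (B₁ λ′) (aff (- 1#) 0#)
  minus-one-torsion = solve 1 (λ l → let m1 = :- con (+ 1) in con (+ 0) :* con (+ 0)
    := m1 :* (m1 :* m1) :+ (l :* l :+ con (+ 1)) :* (m1 :* m1) :+ (l :* l) :* m1) refl

  -- If Q = 2P then x(Q) − 0 = λ and x(Q) − (−1) = λ + 1 are squares.
  halvable⇒squares : ∀ {λ′ yQ} → DivisibleBy2E₁ λ′ (aff λ′ yQ) → IsSquare λ′ × IsSquare (λ′ + 1#)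
  halvable⇒squares (O , _ , ())
  halvable⇒squares {λ′} (P@(aff _ _) , onP , dbl) =
      square-resp (x-0≈x λ′) (double-minus-root-square onP′ (origin-torsion _ _) dbl)
    , square-resp (+-congˡ (⁻¹-involutive 1#)) (double-minus-root-square onP′ (minus-one-torsion λ′) dbl)
    where
    onP′ : OnCurve (A₁ λ′) (B₁ λ′) P
    onP′ = onE₁⇒onCurve P onP

  -- Conversely, with λ = a², λ + 1 = b² and t = y_Q/(ab), halving applies with q = 1, p = λ².
  squares⇒halvable : ¬ (2# ≈ 0#) → ∀ {λ′ yQ} → ¬ (λ′ ≈ 0#) → ¬ (λ′ ≈ 1#) → ¬ (λ′ ≈ - 1#) →
                     OnE₁ λ′ (aff λ′ yQ) → IsSquare λ′ × IsSquare (λ′ + 1#) → DivisibleBy2E₁ λ′ (aff λ′ yQ)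
  squares⇒halvable char≠2 {λ′} {yQ} λ≢0 λ≢1 λ≢-1 onQ ((a , a²≈λ) , (b , b²≈λ+1)) =
    let P , onP , dbl = divisible-resp A≈ B≈ a²≈λ kt≈yQ (halving char≠2 a b t q≢0 p≢0 p≢q)
    in  P , onCurve⇒onE₁ P onP , dbl
    where
    N k t : Carrier
    N = λ′ * (λ′ + 1#)
    k = a * b

    λ+1≢0 : ¬ (λ′ + 1# ≈ 0#)
    λ+1≢0 λ+1≈0 = λ≢-1 (inverseˡ-unique λ′ 1# λ+1≈0)

    N≢0 : ¬ (N ≈ 0#)
    N≢0 = *-nonzero λ≢0 λ+1≢0

    k²≈N : k ² ≈ N
    k²≈N = trans (solve 2 (λ a b → (a :* b) :* (a :* b) := (a :* a) :* (b :* b)) refl a b) (*-cong a²≈λ b²≈λ+1)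

    k≢0 : ¬ (k ≈ 0#)
    k≢0 k≈0 = N≢0 (trans (sym k²≈N) (trans (*-congʳ k≈0) (zeroˡ k)))

    t = yQ * inv k k≢0

    kt≈yQ : k * t ≈ yQ
    kt≈yQ = begin
      k * (yQ * inv k k≢0)    ≈⟨ solve 3 (λ k y i → k :* (y :* i) := y :* (k :* i)) refl k yQ (inv k k≢0) ⟩
      yQ * (k * inv k k≢0)    ≈⟨ *-congˡ (inv-r k k≢0) ⟩
      yQ * 1#                 ≈⟨ *-identityʳ yQ ⟩
      yQ                      ∎

    -- t² = λ(λ + 1), since (kt)² = y_Q² = (λ(λ + 1))² and k² = λ(λ + 1) ≠ 0.
    t²≈N : t ² ≈ N
    t²≈N = *-cancelˡ N≢0 (begin
      N * t ²                          ≈⟨ *-congʳ k²≈N ⟨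
      k ² * t ²                        ≈⟨ solve 2 (λ k t → (k :* k) :* (t :* t) := (k :* t) :* (k :* t)) refl k t ⟩
      (k * t) ²                        ≈⟨ *-cong kt≈yQ kt≈yQ ⟩
      yQ ²                             ≈⟨ onQ ⟩
      (λ′ + λ′ ²) * (λ′ + 1#) * λ′     ≈⟨ solve 1 (λ l → (l :+ l :* l) :* (l :+ con (+ 1)) :* l
                                                     := (l :* (l :+ con (+ 1))) :* (l :* (l :+ con (+ 1)))) refl λ′ ⟩
      N * N                            ∎)

    q≈1 : b ² - a ² ≈ 1#
    q≈1 = consecutive-squares a²≈λ b²≈λ+1

    p≈λ² : t ² - a ² ≈ λ′ ²
    p≈λ² = trans (+-cong t²≈N (-‿cong a²≈λ))
                 (solve 1 (λ l → l :* (l :+ con (+ 1)) :- l := l :* l) refl λ′)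

    q≢0 : ¬ (b ² - a ² ≈ 0#)
    q≢0 q≈0 = 0≉1 (trans (sym q≈0) q≈1)

    p≢0 : ¬ (t ² - a ² ≈ 0#)
    p≢0 p≈0 = *-nonzero λ≢0 λ≢0 (trans (sym p≈λ²) p≈0)

    -- p = q would mean λ² = 1, i.e. (λ − 1)(λ + 1) = 0.
    p≢q : ¬ (t ² - a ² ≈ b ² - a ²)
    p≢q p≈q = *-nonzero (λ λ-1≈0 → λ≢1 (x∙y⁻¹≈ε⇒x≈y λ′ 1# λ-1≈0)) λ+1≢0 (begin
      (λ′ - 1#) * (λ′ + 1#)  ≈⟨ solve 1 (λ l → (l :- con (+ 1)) :* (l :+ con (+ 1)) := l :* l :- con (+ 1)) refl λ′ ⟩
      λ′ ² - 1#              ≈⟨ +-congʳ (trans (sym p≈λ²) (trans p≈q q≈1)) ⟩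
      1# - 1#                ≈⟨ -‿inverseʳ 1# ⟩
      0#                     ∎)

    A≈ : (b ² - a ²) + (t ² - a ²) ≈ A₁ λ′
    A≈ = trans (+-cong q≈1 p≈λ²) (+-comm 1# (λ′ ²))

    B≈ : (b ² - a ²) * (t ² - a ²) ≈ B₁ λ′
    B≈ = trans (*-cong q≈1 p≈λ²) (*-identityˡ (λ′ ²))

lemma6p1 : {a ℓ : Level} (K : Field a ℓ) →
    let open EllipticCurve K in
    (char≠2 : ¬ (2# ≈ 0#)) →
    (λ′ : Carrier) → ¬ (λ′ ≈ 0#) → ¬ (λ′ ≈ 1#) → ¬ (λ′ ≈ - 1#) →
    (yQ : Carrier) → OnE₁ λ′ (aff λ′ yQ) →
    DivisibleBy2E₁ λ′ (aff λ′ yQ) ⇔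
      Σ Carrier (λ c → Σ (Admissible c) (λ adm →
        λ′ ≈ ((c - inv c (proj₁ adm)) * inv 2# char≠2) ²))
lemma6p1 K char≠2 λ′ λ≢0 λ≢1 λ≢-1 yQ onQ = mk⇔
  (λ halvable → squares⇒parameter char≠2 λ≢0 λ≢1 λ≢-1 (halvable⇒squares halvable))
  (λ { (c , adm , λ≈) → squares⇒halvable char≠2 λ≢0 λ≢1 λ≢-1 onQ (parameter⇒squares char≠2 (proj₁ adm) λ≈) })
  where
  open Parametrisation K using (squares⇒parameter; parameter⇒squares)
  open CurveE₁ K using (halvable⇒squares; squares⇒halvable)
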